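{- If $\mathit{cfg}$ is a $T1$-node of $\mathbb{T}^S(G)$, then there is no final configuration $\mathit{cfg}'=[C_1,\ldots,C_m]$ (i.e., configuration at depth $s$) below or equal to $\mathit{cfg}$ in $\mathbb{T}^S(G)$ such that $\mathit{repr}(\mathit{cfg}')$ is a maximal clique-partition of $G$.
   Context: Let $G=(V,E)$ be a finite undirected graph. A clique is a nonempty set of pairwise adjacent vertices; it is maximal if not properly contained in another clique. A clique-partition of $G$ is a partition of $V$ into cliques; it is maximal if it does not contain two different cliques $C,C'$ with $C\cup C'$ a clique. Fix an enumeration $\overline{C}_1,\ldots,\overline{C}_m$ of all maximal cliques of $G$. For $v\in V$ let $\mathit{cliques}(v):=\{i\in[m]\mid v\in\overline{C}_i\}$, $d(v):=|\mathit{cliques}(v)|$, and for nonempty $C\subseteq V$ let $\mathit{cliques}(C):=\bigcap_{v\in C}\mathit{cliques}(v)$. Let $\mathit{Rgd}:=\{k\in[m]\mid \exists v\in V,\ \mathit{cliques}(v)=\{k\}\}$. Fix an enumeration $S=[v_1,\ldots,v_s]$ of all vertices $v$ with $d(v)>1$. A configuration is a list $[C_1,\ldots,C_m]$ where each $C_i$ is empty or a clique, $C_i\subseteq\overline{C}_i$, and $\bigcup_i C_i=V$; $\mathit{repr}([C_1,\ldots,C_m]):=\{C_i\mid C_i\neq\emptyset\}$. Write $[C_1,\ldots,C_m]\to_{(v,i)}[C'_1,\ldots,C'_m]$ if $v\in C_i$, $C'_i=C_i$ and $C'_j=C_j\setminus\{v\}$ for $j\neq i$. The search tree $\mathbb{T}^S(G)$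 has root $[\overline{C}_1,\ldots,\overline{C}_m]$ at depth $0$; a node at depth $k<s$ carrying $\mathit{cfg}$ has, for each $i\in\mathit{cliques}(v_{k+1})$, a child at depth $k+1$ carrying $\mathit{cfg}'$ with $\mathit{cfg}\to_{(v_{k+1},i)}\mathit{cfg}'$. For a node reached by $\mathit{cfg}_0\to_{(v_1,i_1)}\cdots\to_{(v_\ell,i_\ell)}\mathit{cfg}$ set $\delta(\mathit{cfg}):=[i_1,\ldots,i_\ell]$. A node $\mathit{cfg}=[C_1,\ldots,C_m]$ with $\delta(\mathit{cfg})=[i_1,\ldots,i_\ell]$ is a $T1$-node if either (a) $\mathit{cliques}(C_a)\cap\mathit{Rgd}\neq\emptyset$ for some $a\in\{i_1,\ldots,i_\ell\}\setminus\mathit{Rgd}$, or (b) $\mathit{cliques}(C_a)\cap\mathit{cliques}(C_b)\neq\emptyset$ for distinct $a,b\in\{i_1,\ldots,i_\ell\}$. -}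

module Defs where

open import Level using (0ℓ)
open import Data.Nat using (ℕ; _<_)
open import Data.Fin using (Fin; toℕ)
open import Data.Fin.Subset using (Subset; _∈_; _∉_; _⊆_; _∪_; ∣_∣; Nonempty)
open import Data.Vec using (lookup; tabulate)
open import Data.List using (List; []; _++_; [_]; length)
import Data.List.Membership.Propositional as LM
open import Data.Product using (Σ; ∃; _×_; _,_)
open import Relation.Binary.PropositionalEquality using (_≡_; _≢_)
open import Relation.Nullary using (¬_)

record Graph : Set₁ where
  field
    n     : ℕ
    Adj   : Fin n → Fin n → Set
    sym   : ∀ {u v} → Adj u v → Adj v u
    irrefl : ∀ {v} → ¬ Adj v v

module GraphDefs (G : Graph) where
  open Graph G

  IsClique : Subset n → Set
  IsClique C = Nonempty C × (∀ {u v} → u ∈ C → v ∈ C → u ≢ v → Adj u v)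

  IsMaximalClique : Subset n → Set
  IsMaximalClique C = IsClique C × (∀ D → IsClique D → C ⊆ D → D ⊆ C)

  SetFamily : Set₁
  SetFamily = Subset n → Set

  IsCliquePartition : SetFamily → Set
  IsCliquePartition P =
    (∀ C → P C → IsClique C) ×
    (∀ v → ∃ λ C → P C × v ∈ C) ×
    (∀ C D v → P C → P D → v ∈ C → v ∈ D → C ≡ D)

  IsMaximalCliquePartition : SetFamily → Set
  IsMaximalCliquePartition P =
    IsCliquePartition P ×
    (∀ C D → P C → P D → C ≢ D → ¬ IsClique (C ∪ D))

  -- everything relative to a fixed enumeration Cbar of the maximal cliques
  module CliqueDefs {m : ℕ} (Cbar : Fin m → Subset n) where

    cliques : Fin n → Subset m
    cliques v = tabulate (λ i → lookup (Cbar i) v)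

    d : Fin n → ℕ
    d v = ∣ cliques v ∣

    -- cliques(C) = ⋂_{v ∈ C} cliques(v), as a membership predicate:
    -- k ∈ cliques(C) iff every v ∈ C lies in Cbar k
    _∈cliquesOf_ : Fin m → Subset n → Set
    k ∈cliquesOf C = ∀ {v} → v ∈ C → v ∈ Cbar k

    Rgd : Fin m → Set
    Rgd k = ∃ λ v → ∀ i → (i ∈ cliques v → i ≡ k) × (i ≡ k → i ∈ cliques v)

    Config : Set
    Config = Fin m → Subset n

    IsConfiguration : Config → Set
    IsConfiguration cfg =
      (∀ i → (∀ v → v ∉ cfg i) ⊎' IsClique (cfg i)) ×
      (∀ i → cfg i ⊆ Cbar i) ×
      (∀ v → ∃ λ i → v ∈ cfg i)
      where
        open import Data.Sum renaming (_⊎_ to _⊎'_)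

    repr : Config → SetFamily
    repr cfg C = ∃ λ i → Nonempty (cfg i) × C ≡ cfg i

    Step : Fin n → Fin m → Config → Config → Set
    Step v i cfg cfg' =
      v ∈ cfg i ×
      cfg' i ≡ cfg i ×
      (∀ j → j ≢ i → ∀ u → (u ∈ cfg' j → u ∈ cfg j × u ≢ v) × (u ∈ cfg j → u ≢ v → u ∈ cfg' j))

    module Tree {s : ℕ} (S : Fin s → Fin n) where

      -- Node δ cfg : there is a node of the tree with δ(node) = δ carrying cfg
      -- (the depth of the node is length δ)
      data Node : List (Fin m) → Config → Set where
        root  : Node [] Cbar
        child : ∀ {δ cfg cfg' i} (k : Fin s) → toℕ k ≡ length δ →
                Node δ cfg → i ∈ cliques (S k) → Step (S k) i cfg cfg' →
                Node (δ ++ [ i ]) cfg'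

      open LM using () renaming (_∈_ to _∈ᴸ_)

      T1 : List (Fin m) → Config → Set
      T1 δ cfg =
        (∃ λ a → a ∈ᴸ δ × ¬ Rgd a × ∃ λ k → k ∈cliquesOf cfg a × Rgd k)
        ⊎'
        (∃ λ a → ∃ λ b → a ∈ᴸ δ × b ∈ᴸ δ × a ≢ b ×
           ∃ λ k → k ∈cliquesOf cfg a × k ∈cliquesOf cfg b)
        where
          open import Data.Sum renaming (_⊎_ to _⊎'_)

module Submission where

-- A node's configuration is determined by its path δ: C_i consists of the vertices of C̄_i that
-- δ assigns to no clique other than i. Hence configurations only shrink down the tree, a vertex
-- assigned to a stays in C_a and in no other C_j, and a vertex whose only maximal clique is k
-- stays in C_k. At a T1-node this yields, in every descendant, two distinct nonempty blocks
-- inside a common maximal clique C̄_k; their union is a clique, so the blocks could be merged.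
-- The argument never uses that the descendant is final.

open import Defs
open import Data.Nat using (ℕ; _<_; zero; suc)
open import Data.Fin using (Fin; toℕ; _≟_)
open import Data.Fin.Subset using (Subset; _∈_; _⊆_; _∪_; Nonempty)
open import Data.Fin.Properties using (toℕ-injective)
open import Data.Fin.Subset.Properties using (x∈p∪q⁻; p⊆p∪q)
open import Data.Vec using (lookup; tabulate)
open import Data.Vec.Properties using ([]=⇒lookup; lookup⇒[]=; lookup∘tabulate)
open import Data.List using (List; []; _∷_; _++_; [_]; length)
import Data.List.Relation.Unary.Any as Any
import Data.List.Membership.Propositional as List
open import Data.List.Membership.Propositional.Properties using (∈-++⁻)
open import Data.Product using (∃; _×_; _,_; proj₁; proj₂)
open import Data.Sum using (_⊎_; inj₁; inj₂)
import Data.Sum as Sum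
open import Data.Empty using (⊥-elim)
open import Function using (_∘′_)
open import Function.Definitions using (Injective)
open import Relation.Binary.PropositionalEquality using (_≡_; refl; sym; trans; subst; cong; _≢_)
open import Relation.Nullary using (¬_; yes; no)

infix 4 _[_]=_

data _[_]=_ {A : Set} : List A → ℕ → A → Set where
  here  : ∀ {x xs} → x ∷ xs [ zero ]= x
  there : ∀ {x y xs n} → xs [ n ]= x → y ∷ xs [ suc n ]= x

module _ {A : Set} where

  []=-++ : ∀ {xs : List A} ys {n x} → xs [ n ]= x → xs ++ ys [ n ]= x
  []=-++ ys here        = here
  []=-++ ys (there x∈) = there ([]=-++ ys x∈)

  []=-∷ʳ⁻ : ∀ (xs : List A) {y n x} → xs ++ [ y ] [ n ]= x →
    xs [ n ]= x ⊎ (n ≡ length xs × x ≡ y)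
  []=-∷ʳ⁻ []       here        = inj₂ (refl , refl)
  []=-∷ʳ⁻ (_ ∷ _)  here        = inj₁ here
  []=-∷ʳ⁻ (_ ∷ xs) (there x∈) with []=-∷ʳ⁻ xs x∈
  ... | inj₁ x∈xs         = inj₁ (there x∈xs)
  ... | inj₂ (n≡len , x≡y) = inj₂ (cong suc n≡len , x≡y)

  []=-∷ʳ-last : ∀ (xs : List A) {y} → xs ++ [ y ] [ length xs ]= y
  []=-∷ʳ-last []       = here
  []=-∷ʳ-last (_ ∷ xs) = there ([]=-∷ʳ-last xs)

  []=-functional : ∀ {xs : List A} {n x y} → xs [ n ]= x → xs [ n ]= y → x ≡ y
  []=-functional here        here        = refl
  []=-functional (there x∈) (there y∈) = []=-functional x∈ y∈

module _ (G : Graph) where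
  open Graph G using (n)
  open GraphDefs G

  ∪-⊆ : ∀ {C D K : Subset n} → C ⊆ K → D ⊆ K → C ∪ D ⊆ K
  ∪-⊆ {C} {D} C⊆K D⊆K x∈ = Sum.[ C⊆K , D⊆K ] (x∈p∪q⁻ C D x∈)

  ⊆-clique-isClique : ∀ {C K} → IsClique K → Nonempty C → C ⊆ K → IsClique C
  ⊆-clique-isClique (_ , adjacent) nonempty C⊆K =
    nonempty , λ u∈ v∈ u≢v → adjacent (C⊆K u∈) (C⊆K v∈) u≢v

  ¬maximal-if-blocks-⊆-clique : ∀ {P C D K} → IsClique K → P C → P D → C ≢ D →
    Nonempty C → C ⊆ K → D ⊆ K → ¬ IsMaximalCliquePartition P
  ¬maximal-if-blocks-⊆-clique {D = D} K-clique C∈P D∈P C≢D (x , x∈C) C⊆K D⊆K (_ , unmergeable) =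
    unmergeable _ _ C∈P D∈P C≢D
      (⊆-clique-isClique K-clique (x , p⊆p∪q D x∈C) (∪-⊆ C⊆K D⊆K))

module SearchTree (G : Graph) {m : ℕ} (Cbar : Fin m → Subset (Graph.n G))
                  {s : ℕ} (S : Fin s → Fin (Graph.n G)) where
  open Graph G using (n)
  open GraphDefs G
  open CliqueDefs Cbar
  open Tree S

  ∈cliques⇒∈Cbar : ∀ {i v} → i ∈ cliques v → v ∈ Cbar i
  ∈cliques⇒∈Cbar {i} {v} i∈ = lookup⇒[]= v (Cbar i)
    (trans (sym (lookup∘tabulate (λ j → lookup (Cbar j) v) i)) ([]=⇒lookup i∈))

  ∈Cbar⇒∈cliques : ∀ {i v} → v ∈ Cbar i → i ∈ cliques v
  ∈Cbar⇒∈cliques {i} {v} v∈ = lookup⇒[]= i (cliques v)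
    (trans (lookup∘tabulate (λ j → lookup (Cbar j) v) i) ([]=⇒lookup v∈))

  -- Entry number p of a path δ is the clique chosen for the vertex S p (the paper's v_{p+1}).
  Assigns : List (Fin m) → Fin n → Fin m → Set
  Assigns δ u a = ∃ λ p → δ [ toℕ p ]= a × S p ≡ u

  AssignedOnlyTo : List (Fin m) → Fin n → Fin m → Set
  AssignedOnlyTo δ u i = ∀ {a} → Assigns δ u a → a ≡ i

  assigns-++ : ∀ {δ} rest {u a} → Assigns δ u a → Assigns (δ ++ rest) u a
  assigns-++ rest (p , a∈ , Sp≡u) = p , []=-++ rest a∈ , Sp≡u

  assigns-∷ʳ⁻ : ∀ {δ i u a} {k : Fin s} → toℕ k ≡ length δ →
    Assigns (δ ++ [ i ]) u a → Assigns δ u a ⊎ (u ≡ S k × a ≡ i)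
  assigns-∷ʳ⁻ {δ} k≡len (p , a∈ , Sp≡u) with []=-∷ʳ⁻ δ a∈
  ... | inj₁ a∈δ            = inj₁ (p , a∈δ , Sp≡u)
  ... | inj₂ (p≡len , a≡i) =
    inj₂ (trans (sym Sp≡u) (cong S (toℕ-injective (trans p≡len (sym k≡len)))) , a≡i)

  assigns-∷ʳ-last : ∀ {δ i} {k : Fin s} → toℕ k ≡ length δ → Assigns (δ ++ [ i ]) (S k) i
  assigns-∷ʳ-last {δ} {i} {k} k≡len =
    k , subst (λ t → δ ++ [ i ] [ t ]= i) (sym k≡len) ([]=-∷ʳ-last δ) , refl

  assigns-functional : Injective _≡_ _≡_ S → ∀ {δ u a b} → Assigns δ u a → Assigns δ u b → a ≡ b
  assigns-functional S-injective (p , a∈ , refl) (q , b∈ , Sq≡Sp)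
    with refl ← S-injective Sq≡Sp = []=-functional a∈ b∈

  assignedOnlyTo-++⁻ : ∀ {δ} rest {u i} → AssignedOnlyTo (δ ++ rest) u i → AssignedOnlyTo δ u i
  assignedOnlyTo-++⁻ rest only = only ∘′ assigns-++ rest

  assignedOnlyTo-∷ʳ : ∀ {δ i u j} {k : Fin s} → toℕ k ≡ length δ →
    AssignedOnlyTo δ u j → (u ≡ S k → i ≡ j) → AssignedOnlyTo (δ ++ [ i ]) u j
  assignedOnlyTo-∷ʳ k≡len only new-ok asg with assigns-∷ʳ⁻ k≡len asg
  ... | inj₁ asg-δ        = only asg-δ
  ... | inj₂ (u≡Sk , refl) = new-ok u≡Sk

  node-assigns-cliques : ∀ {δ cfg u a} → Node δ cfg → Assigns δ u a → u ∈ Cbar a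
  node-assigns-cliques root (_ , () , _)
  node-assigns-cliques (child k k≡len node i∈ _) asg with assigns-∷ʳ⁻ k≡len asg
  ... | inj₁ asg-δ          = node-assigns-cliques node asg-δ
  ... | inj₂ (refl , refl) = ∈cliques⇒∈Cbar i∈

  node-entries-assigned : ∀ {δ cfg a} → Node δ cfg → a List.∈ δ → ∃ λ u → Assigns δ u a
  node-entries-assigned root ()
  node-entries-assigned (child {δ} {i = i} k k≡len node _ _) a∈ with ∈-++⁻ δ a∈
  ... | inj₁ a∈δ = let (u , asg) = node-entries-assigned node a∈δ in u , assigns-++ [ i ] asg
  ... | inj₂ (Any.here refl) = S k , assigns-∷ʳ-last k≡len

  config-sound : ∀ {δ cfg i u} → Node δ cfg → u ∈ cfg i → u ∈ Cbar i × AssignedOnlyTo δ u i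
  config-sound root u∈ = u∈ , λ { (_ , () , _) }
  config-sound {i = j} {u} (child {i = i} k k≡len node _ (_ , same , others)) u∈ with j ≟ i
  ... | yes refl =
    let (u∈Cbar , only) = config-sound node (subst (u ∈_) same u∈)
    in u∈Cbar , assignedOnlyTo-∷ʳ k≡len only (λ _ → refl)
  ... | no j≢i =
    let (u∈cfg , u≢Sk) = proj₁ (others j j≢i u) u∈
        (u∈Cbar , only) = config-sound node u∈cfg
    in u∈Cbar , assignedOnlyTo-∷ʳ k≡len only (λ u≡Sk → ⊥-elim (u≢Sk u≡Sk))

  config-complete : ∀ {δ cfg i u} → Node δ cfg → u ∈ Cbar i → AssignedOnlyTo δ u i → u ∈ cfg i
  config-complete root u∈ _ = u∈
  config-complete {i = j} {u} (child {i = i} k k≡len node _ (_ , same , others)) u∈ only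
    with j ≟ i
  ... | yes refl = subst (u ∈_) (sym same) (config-complete node u∈ (assignedOnlyTo-++⁻ [ i ] only))
  ... | no j≢i   = proj₂ (others j j≢i u)
    (config-complete node u∈ (assignedOnlyTo-++⁻ [ i ] only))
    (λ { refl → j≢i (sym (only (assigns-∷ʳ-last k≡len))) })

  config-⊆-Cbar : ∀ {δ cfg} → Node δ cfg → ∀ i → cfg i ⊆ Cbar i
  config-⊆-Cbar node i u∈ = proj₁ (config-sound node u∈)

  config-antitone : ∀ {δ rest cfg cfg'} → Node δ cfg → Node (δ ++ rest) cfg' →
    ∀ i → cfg' i ⊆ cfg i
  config-antitone {rest = rest} node node' i u∈ =
    let (u∈Cbar , only) = config-sound node' u∈
    in config-complete node u∈Cbar (assignedOnlyTo-++⁻ rest only)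

  entry-owned : Injective _≡_ _≡_ S → ∀ {δ rest cfg cfg' a} → Node δ cfg → Node (δ ++ rest) cfg' →
    a List.∈ δ → ∃ λ v → v ∈ cfg' a × (∀ {j} → v ∈ cfg' j → a ≡ j)
  entry-owned S-injective {rest = rest} node node' a∈ =
    let (v , asg-δ) = node-entries-assigned node a∈
        asg = assigns-++ rest asg-δ
    in v
     , config-complete node' (node-assigns-cliques node' asg)
         (λ asg' → assigns-functional S-injective asg' asg)
     , λ v∈ → proj₂ (config-sound node' v∈) asg

  module _ {w k} (w-rigid : ∀ i → (i ∈ cliques w → i ≡ k) × (i ≡ k → i ∈ cliques w)) where

    rigid-∈config : ∀ {δ cfg} → Node δ cfg → w ∈ cfg k
    rigid-∈config node = config-complete node (∈cliques⇒∈Cbar (proj₂ (w-rigid k) refl))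
      (λ asg → proj₁ (w-rigid _) (∈Cbar⇒∈cliques (node-assigns-cliques node asg)))

    rigid-only-in : ∀ {δ cfg j} → Node δ cfg → w ∈ cfg j → j ≡ k
    rigid-only-in node w∈ = proj₁ (w-rigid _) (∈Cbar⇒∈cliques (config-⊆-Cbar node _ w∈))

proposition1 : (G : Graph) (m : ℕ) (Cbar : Fin m → Subset (Graph.n G)) →
    (∀ i → GraphDefs.IsMaximalClique G (Cbar i)) →
    (∀ C → GraphDefs.IsMaximalClique G C → ∃ λ i → Cbar i ≡ C) →
    Injective _≡_ _≡_ Cbar →
    (s : ℕ) (S : Fin s → Fin (Graph.n G)) →
    Injective _≡_ _≡_ S →
    (∀ k → 1 < GraphDefs.CliqueDefs.d G Cbar (S k)) →
    (∀ v → 1 < GraphDefs.CliqueDefs.d G Cbar v → ∃ λ k → S k ≡ v) →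
    ∀ δ cfg →
    GraphDefs.CliqueDefs.Tree.Node G Cbar S δ cfg →
    GraphDefs.CliqueDefs.Tree.T1 G Cbar S δ cfg →
    ∀ δ' cfg' →
    GraphDefs.CliqueDefs.Tree.Node G Cbar S δ' cfg' →
    (∃ λ rest → δ' ≡ δ ++ rest) →
    length δ' ≡ s →
    ¬ GraphDefs.IsMaximalCliquePartition G (GraphDefs.CliqueDefs.repr G Cbar cfg')
proposition1 G m Cbar maximal _ _ s S S-injective _ _ δ cfg node t1 _ cfg' node' (rest , refl) _
  with t1
... | inj₁ (a , a∈δ , ¬rigid-a , k , k⊇cfg-a , w , w-rigid) =
  let (v , v∈a , _) = entry-owned S-injective node node' a∈δ
      w∈k = rigid-∈config w-rigid node'
      a≡k cfg'a≡cfg'k = rigid-only-in w-rigid node' (subst (w ∈_) (sym cfg'a≡cfg'k) w∈k)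
  in ¬maximal-if-blocks-⊆-clique G (proj₁ (maximal k)) (a , (v , v∈a) , refl) (k , (w , w∈k) , refl)
       (λ cfg'a≡cfg'k → ¬rigid-a (subst Rgd (sym (a≡k cfg'a≡cfg'k)) (w , w-rigid)))
       (v , v∈a) (λ u∈ → k⊇cfg-a (config-antitone node node' a u∈)) (config-⊆-Cbar node' k)
  where open SearchTree G Cbar S
        open GraphDefs.CliqueDefs G Cbar using (Rgd)
... | inj₂ (a , b , a∈δ , b∈δ , a≢b , k , k⊇cfg-a , k⊇cfg-b) =
  let (v , v∈a , v-only-a) = entry-owned S-injective node node' a∈δ
      (u , u∈b , _) = entry-owned S-injective node node' b∈δ
  in ¬maximal-if-blocks-⊆-clique G (proj₁ (maximal k)) (a , (v , v∈a) , refl) (b , (u , u∈b) , refl)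
       (λ a≡b → a≢b (v-only-a (subst (v ∈_) a≡b v∈a)))
       (v , v∈a) (λ x∈ → k⊇cfg-a (config-antitone node node' a x∈))
       (λ x∈ → k⊇cfg-b (config-antitone node node' b x∈))
  where open SearchTree G Cbar S
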